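{- For every agent $i$, the schema $U_i(\phi\land\psi)\to U_i\phi\lor U_i\psi$ is not valid: there exist formulas $\phi,\psi$ of $\mathbf{LUT}$ such that $\nvDash U_i(\phi\land\psi)\to U_i\phi\lor U_i\psi$.
   Context: Let $\mathbf{P}$ be a countably infinite set of propositional variables and $\mathbf{I}$ a finite set of agents. The language $\mathbf{LUT}$ is given by $\phi::= p\mid\neg\phi\mid(\phi\land\phi)\mid K_i\phi\mid[\phi]\phi\mid U_i\phi$ ($p\in\mathbf{P}$, $i\in\mathbf{I}$); $\mathbf{EL}$ is the fragment without $[\cdot]$ and $U_i$. A model is $\mathcal{M}=\langle S,\{R_i\}_{i\in\mathbf{I}},V\rangle$ with $S\neq\emptyset$, each $R_i$ a reflexive relation on $S$, $V:\mathbf{P}\to2^S$. Truth: $p$ true at $s$ iff $s\in V(p)$; Boolean clauses as usual; $\mathcal{M},s\vDash K_i\phi$ iff $\phi$ holds at all $t$ with $sR_it$; $\mathcal{M},s\vDash[\psi]\phi$ iff ($\mathcal{M},s\vDash\psi$ implies $\mathcal{M}|_\psi,s\vDash\phi$), with $\mathcal{M}|_\psi$ the restriction of $\mathcal{M}$ to the states where $\psi$ is true; $\mathcal{M},s\vDash U_i\phi$ iff $\mathcal{M},s\vDash\phi$ and for all $\psi\in\mathbf{EL}$, $\mathcal{M},s\vDash[\psi]\neg K_i\phi$. $\vDash\phi$ means $\phi$ is true at every state of every model. -}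

module Defs where

open import Data.Nat using (ℕ)
open import Data.Fin using (Fin)
open import Data.Product using (Σ; _×_; _,_; proj₁)
open import Data.Empty using (⊥)
open import Relation.Nullary using (¬_)

Prop : Set
Prop = ℕ

data EL (n : ℕ) : Set where
  var  : Prop → EL n
  ¬ₑ_  : EL n → EL n
  _∧ₑ_ : EL n → EL n → EL n
  Kₑ   : Fin n → EL n → EL n

data LUT (n : ℕ) : Set where
  var  : Prop → LUT n
  ~_   : LUT n → LUT n
  _∧_  : LUT n → LUT n → LUT n
  K    : Fin n → LUT n → LUT n
  [_]_ : LUT n → LUT n → LUT n
  U    : Fin n → LUT n → LUT n

embed : ∀ {n} → EL n → LUT n
embed (var p)   = var p
embed (¬ₑ φ)    = ~ embed φ
embed (φ ∧ₑ ψ)  = embed φ ∧ embed ψ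
embed (Kₑ i φ)  = K i (embed φ)

_∨_ : ∀ {n} → LUT n → LUT n → LUT n
φ ∨ ψ = ~ ((~ φ) ∧ (~ ψ))

_⇒_ : ∀ {n} → LUT n → LUT n → LUT n
φ ⇒ ψ = ~ (φ ∧ (~ ψ))

record Model (n : ℕ) : Set₁ where
  field
    S    : Set
    inh  : S
    R    : Fin n → S → S → Set
    refl : ∀ i s → R i s s
    V    : Prop → S → Set

open Model public

-- Restriction of a model to the states satisfying a predicate P,
-- given a witness state in P (to keep the carrier nonempty).
restrict : ∀ {n} (M : Model n) (P : S M → Set) → Σ (S M) P → Model n
restrict M P w = record
  { S    = Σ (S M) P
  ; inh  = w
  ; R    = λ i x y → R M i (proj₁ x) (proj₁ y)
  ; refl = λ i x → refl M i (proj₁ x)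
  ; V    = λ p x → V M p (proj₁ x)
  }

satEL : ∀ {n} (M : Model n) → S M → EL n → Set
satEL M s (var p)  = V M p s
satEL M s (¬ₑ φ)   = ¬ satEL M s φ
satEL M s (φ ∧ₑ ψ) = satEL M s φ × satEL M s ψ
satEL M s (Kₑ i φ) = ∀ t → R M i s t → satEL M t φ

-- Truth of LUT formulas
-- M, s ⊨ [ψ]φ  iff  M,s ⊨ ψ implies M|ψ, s ⊨ φ
-- M, s ⊨ U_i φ iff  M,s ⊨ φ and for all EL ψ, M,s ⊨ [ψ]¬K_i φ,
--   the latter written out: M,s ⊨ ψ implies not (M|ψ, s ⊨ K_i φ).
-- (For ψ ∈ EL, truth of embed ψ coincides with satEL; satEL is used to keep
--  the recursion structural.)
sat : ∀ {n} (M : Model n) → S M → LUT n → Set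
sat M s (var p)   = V M p s
sat M s (~ φ)     = ¬ sat M s φ
sat M s (φ ∧ ψ)   = sat M s φ × sat M s ψ
sat M s (K i φ)   = ∀ t → R M i s t → sat M t φ
sat M s ([ ψ ] φ) = (h : sat M s ψ) →
  sat (restrict M (λ x → sat M x ψ) (s , h)) (s , h) φ
sat M s (U i φ)   = sat M s φ ×
  ((ψ : EL _) (h : satEL M s ψ) →
    ¬ (∀ t → R M i s (proj₁ t) →
         sat (restrict M (λ x → satEL M x ψ) (s , h)) t φ))

Valid : ∀ {n} → LUT n → Set₁
Valid {n} φ = (M : Model n) (s : S M) → sat M s φ

{-# OPTIONS --safe #-}
module Submission where

-- The Moore sentence p ∧ ¬K p can never become known, since knowing it would mean knowing
-- p and, by reflexivity, not knowing p; so it is understood wherever it is true.  Neither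
-- conjunct is understood, though: announcing p makes p known, and in a two-point model with
-- a universal relation where p fails at one point, ¬K p is already known everywhere, so the
-- announcement of a tautology makes it known.

open import Defs hiding (refl)
open import Data.Nat using (ℕ)
open import Function using (case_of_)
open import Data.Fin using (Fin)
open import Data.Bool using (Bool; true; false)
open import Data.Unit using (⊤; tt)
open import Data.Product using (∃₂; _,_; proj₁; proj₂)
open import Relation.Binary.PropositionalEquality using (_≡_; refl)
open import Relation.Nullary using (¬_)

⊤ₑ : ∀ {n} → EL n
⊤ₑ = ¬ₑ (var 0 ∧ₑ (¬ₑ var 0))

⊤ₑ-holds : ∀ {n} (M : Model n) (s : S M) → satEL M s ⊤ₑ
⊤ₑ-holds M s (p , ¬p) = ¬p p

module _ {n : ℕ} (i : Fin n) where

  moore-unknowable : (M : Model n) (s : S M) (φ : LUT n) → ¬ sat M s (K i (φ ∧ (~ K i φ)))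
  moore-unknowable M s φ knowsMoore =
    proj₂ (knowsMoore s (Model.refl M i s)) (λ t sRt → proj₁ (knowsMoore t sRt))

  moore-understood : (M : Model n) (s : S M) (φ : LUT n) →
                     sat M s (φ ∧ (~ K i φ)) → sat M s (U i (φ ∧ (~ K i φ)))
  moore-understood M s φ moore =
    moore , λ χ χ-holds → moore-unknowable (restrict M (λ x → satEL M x χ) (s , χ-holds)) (s , χ-holds) φ

  atom-not-understood : (M : Model n) (s : S M) (p : Prop) → ¬ sat M s (U i (var p))
  atom-not-understood M s p (p-holds , neverKnown) = neverKnown (var p) p-holds (λ t _ → proj₂ t)

  ignorance-not-understood : (M : Model n) (p : Prop) (u : S M) → ¬ V M p u →
                             (∀ t → R M i t u) → (s : S M) → ¬ sat M s (U i (~ K i (var p)))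
  ignorance-not-understood M p u ¬pu uAccessible s (_ , neverKnown) =
    neverKnown ⊤ₑ (⊤ₑ-holds M s) (λ t _ knowsP → ¬pu (knowsP (u , ⊤ₑ-holds M u) (uAccessible (proj₁ t))))

coinModel : (n : ℕ) → Model n
coinModel n = record
  { S    = Bool
  ; inh  = true
  ; R    = λ _ _ _ → ⊤
  ; refl = λ _ _ → tt
  ; V    = λ _ x → x ≡ true
  }

mainTheorem9 : (n : ℕ) (i : Fin n) →
    ∃₂ λ (φ ψ : LUT n) → ¬ Valid (U i (φ ∧ ψ) ⇒ (U i φ ∨ U i ψ))
mainTheorem9 n i = var 0 , ~ K i (var 0) , λ valid →
  valid M true (moore-understood i M true (var 0) moore-at-true , λ neither →
    neither (atom-not-understood i M true 0 , ignorance-not-understood i M 0 false (λ ()) (λ _ → tt) true))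
  where
  M : Model n
  M = coinModel n

  moore-at-true : sat M true (var 0 ∧ (~ K i (var 0)))
  moore-at-true = refl , λ knowsP → case knowsP false tt of λ ()
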